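{- $\mathrm{ELDL}\subseteq k\mathrm{STAT}$ and $\mathrm{ELDL}_{\mathrm{poly}}\subseteq k\mathrm{STAT}_{\mathrm{poly}}$.
   Context: All classes are classes of families of Boolean functions on $\{0,1\}^n$; "polynomial" means polynomial in $n$. An exact threshold function is $\mathbf{1}[\langle\mathbf{w},\mathbf{x}\rangle=\theta]$. An exact linear decision list (ELDL) is a sequence of instructions "if $f_i(\mathbf{x})=1$ then output $c_i$" ($i=1,\dots,m$) followed by "output 0", where each $f_i$ is an exact threshold function and $c_i\in\{0,1\}$; its length is $m$ and its maximum weight is the largest coefficient of any $f_i$. $\mathrm{ELDL}$: polynomial length; $\mathrm{ELDL}_{\mathrm{poly}}$: polynomial length and polynomially bounded maximum weight. For a vector $\mathbf{z}$, $\mathbf{z}_{(k)}$ denotes its $k$-th smallest entry. $k\mathrm{STAT}$ is the class of functions $f$ for which there exist linear forms (affine functions) with integer coefficients $L_1,\dots,L_{\ell_1},R_1,\dots,R_{\ell_2}$, $\ell_1+\ell_2$ polynomial in $n$, and integers $k_l,k_r$, such that $f(\mathbf{x})=1\iff(L_1(\mathbf{x}),\dots,L_{\ell_1}(\mathbf{x}))_{(k_l)}<(R_1(\mathbf{x}),\dots,R_{\ell_2}(\mathbf{x}))_{(k_r)}$; $k\mathrm{STAT}_{\mathrm{poly}}$ is the subclass with all coefficients bounded in absolute value by a polynomial in $n$. -}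

module Defs where

open import Data.Nat using (ℕ; zero; suc; _+_; _*_; _^_; _≤_; _⊔_)
open import Data.Integer using (ℤ; ∣_∣; _≤?_; _<?_; _≟_) renaming (_+_ to _+ℤ_; _*_ to _*ℤ_; +_ to ⁺_)
open import Data.Bool using (Bool; true; false; if_then_else_)
open import Data.Vec using (Vec; []; _∷_; lookup; map; foldr)
open import Data.Fin using (Fin)
open import Data.List using (List; length) renaming ([] to []ᴸ; _∷_ to _∷ᴸ_)
open import Data.Product using (Σ; ∃; _×_; _,_)
open import Relation.Nullary.Decidable using (⌊_⌋; does)
open import Relation.Binary.PropositionalEquality using (_≡_)

BoolFamily : Set
BoolFamily = (n : ℕ) → Vec Bool n → Bool

PolyBounded : (ℕ → ℕ) → Set
PolyBounded g = ∃ λ c → (n : ℕ) → g n ≤ c * n ^ c + c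

bit : Bool → ℤ
bit true  = ⁺ 1
bit false = ⁺ 0

dot : ∀ {n} → Vec ℤ n → Vec Bool n → ℤ
dot []       []       = ⁺ 0
dot (w ∷ ws) (b ∷ bs) = w *ℤ bit b +ℤ dot ws bs

maxAbs : ∀ {n} → Vec ℤ n → ℕ
maxAbs []       = 0
maxAbs (w ∷ ws) = ∣ w ∣ ⊔ maxAbs ws

record ExactThreshold (n : ℕ) : Set where
  constructor exactThr
  field
    weights : Vec ℤ n
    θ       : ℤ

evalET : ∀ {n} → ExactThreshold n → Vec Bool n → Bool
evalET (exactThr w θ) x = does (dot w x ≟ θ)

ELDL : ℕ → Set
ELDL n = List (ExactThreshold n × Bool)

evalELDL : ∀ {n} → ELDL n → Vec Bool n → Bool
evalELDL []ᴸ             x = false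
evalELDL ((f , c) ∷ᴸ is) x = if evalET f x then c else evalELDL is x

maxWeightELDL : ∀ {n} → ELDL n → ℕ
maxWeightELDL []ᴸ                     = 0
maxWeightELDL ((exactThr w θ , c) ∷ᴸ is) = maxAbs w ⊔ maxWeightELDL is

InELDL : BoolFamily → Set
InELDL f = Σ ((n : ℕ) → ELDL n) λ D →
  PolyBounded (λ n → length (D n)) ×
  ((n : ℕ) (x : Vec Bool n) → evalELDL (D n) x ≡ f n x)

InELDLpoly : BoolFamily → Set
InELDLpoly f = Σ ((n : ℕ) → ELDL n) λ D →
  PolyBounded (λ n → length (D n)) ×
  PolyBounded (λ n → maxWeightELDL (D n)) ×
  ((n : ℕ) (x : Vec Bool n) → evalELDL (D n) x ≡ f n x)

insert : ∀ {m} → ℤ → Vec ℤ m → Vec ℤ (suc m)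
insert a []       = a ∷ []
insert a (b ∷ bs) = if does (a ≤? b) then a ∷ b ∷ bs else b ∷ insert a bs

sort : ∀ {m} → Vec ℤ m → Vec ℤ m
sort []       = []
sort (a ∷ as) = insert a (sort as)

-- z_(k): the k-th smallest entry; k ∈ {1,…,m} is represented by
-- an index i : Fin m with k = toℕ i + 1.
kthSmallest : ∀ {m} → Vec ℤ m → Fin m → ℤ
kthSmallest z i = lookup (sort z) i

record Affine (n : ℕ) : Set where
  constructor affine
  field
    coeffs : Vec ℤ n
    const  : ℤ

evalAffine : ∀ {n} → Affine n → Vec Bool n → ℤ
evalAffine (affine a b) x = dot a x +ℤ b

maxCoeffAffine : ∀ {n} → Affine n → ℕ
maxCoeffAffine (affine a b) = maxAbs a ⊔ ∣ b ∣

maxCoeffs : ∀ {n m} → Vec (Affine n) m → ℕ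
maxCoeffs []       = 0
maxCoeffs (L ∷ Ls) = maxCoeffAffine L ⊔ maxCoeffs Ls

record KSTAT (n : ℕ) : Set where
  constructor kstat
  field
    ℓ₁ ℓ₂ : ℕ
    Ls    : Vec (Affine n) ℓ₁
    Rs    : Vec (Affine n) ℓ₂
    kₗ    : Fin ℓ₁
    kᵣ    : Fin ℓ₂

evalKSTAT : ∀ {n} → KSTAT n → Vec Bool n → Bool
evalKSTAT (kstat _ _ Ls Rs kl kr) x =
  does (kthSmallest (map (λ L → evalAffine L x) Ls) kl
          <? kthSmallest (map (λ R → evalAffine R x) Rs) kr)

sizeKSTAT : ∀ {n} → KSTAT n → ℕ
sizeKSTAT (kstat ℓ₁ ℓ₂ _ _ _ _) = ℓ₁ + ℓ₂

maxCoeffKSTAT : ∀ {n} → KSTAT n → ℕ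
maxCoeffKSTAT (kstat _ _ Ls Rs _ _) = maxCoeffs Ls ⊔ maxCoeffs Rs

InKSTAT : BoolFamily → Set
InKSTAT f = Σ ((n : ℕ) → KSTAT n) λ S →
  PolyBounded (λ n → sizeKSTAT (S n)) ×
  ((n : ℕ) (x : Vec Bool n) → evalKSTAT (S n) x ≡ f n x)

InKSTATpoly : BoolFamily → Set
InKSTATpoly f = Σ ((n : ℕ) → KSTAT n) λ S →
  PolyBounded (λ n → sizeKSTAT (S n)) ×
  PolyBounded (λ n → maxCoeffKSTAT (S n)) ×
  ((n : ℕ) (x : Vec Bool n) → evalKSTAT (S n) x ≡ f n x)

-- Append to D (of length m) an instruction that always fires with output 0, and tag each
-- instruction with the number t of instructions from it to the end. The kSTAT compares two
-- sides, one for each output value s: on side s an instruction with output s contributes the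
-- affine forms t + K (⟨w,x⟩ − θ) and K − K (⟨w,x⟩ − θ), where K = m + 2, and every other
-- instruction the constants 0 and K + 1. Let Y be the tag of the first instruction that fires.
-- If ⟨w,x⟩ ≠ θ, one of the two forms is ≤ 0 and the other ≥ K; if ⟨w,x⟩ = θ they are t and K.
-- So every pair has exactly one value below Y, except the pair of the first firing instruction
-- on the side of its output, which has none: that side has m values below Y and the other side
-- m + 1, and comparing the (m + 1)-th smallest values of the two sides yields the output.
-- An instruction with |θ| > n · max |w| never fires and gets the constants on both sides, which
-- keeps every coefficient polynomial in m, n and the maximum weight.

module Submission where

open import Defs
open import Data.Nat using (ℕ; zero; suc; z≤n; s≤s; s≤s⁻¹; _+_; _*_; _^_; _≤_; _<_; _≤?_)
import Data.Nat.Properties as ℕP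
open import Data.Integer as ℤ using (ℤ; +_; -[1+_]; 0ℤ; ∣_∣)
import Data.Integer.Properties as ℤP
import Data.Integer.Tactic.RingSolver as ℤ-RingSolver
open import Data.Bool using (Bool; true; false; if_then_else_; _∧_; T)
import Data.Bool as Bool
open import Data.Unit using (tt)
open import Data.Vec using (Vec; []; _∷_; _++_; lookup; map; replicate; count)
open import Data.Vec.Properties using (map-++)
open import Data.Vec.Relation.Unary.All as All using (All; []; _∷_)
import Data.Vec.Relation.Unary.All.Properties as All
open import Data.Vec.Relation.Unary.AllPairs using (AllPairs; []; _∷_)
open import Data.List using (length; [_]) renaming ([] to []ᴸ; _∷_ to _∷ᴸ_; _++_ to _++ᴸ_)
open import Data.List.Properties using (length-++)
open import Data.Product using (_×_; ∃₂; _,_)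
open import Data.Sum using (_⊎_; inj₁; inj₂)
open import Data.Fin using (Fin; zero; suc; toℕ; fromℕ<)
open import Data.Fin.Properties using (toℕ-fromℕ<)
open import Function using (id; _∘′_)
open import Relation.Nullary using (¬_; yes; no; contradiction)
open import Relation.Nullary.Decidable using (does; dec-true; dec-false)
open import Relation.Unary using (Pred; Decidable)
open import Relation.Binary.PropositionalEquality hiding ([_])

private variable
  m n : ℕ

-- Order statistics

module _ {a p} {A : Set a} {P : Pred A p} (P? : Decidable P) where

  count-++ : ∀ (u : Vec A m) (v : Vec A n) → count P? (u ++ v) ≡ count P? u + count P? v
  count-++ []      v = refl
  count-++ (a ∷ u) v with does (P? a)
  ... | true  = cong suc (count-++ u v)
  ... | false = count-++ u v

  count-swap : ∀ a b (v : Vec A m) → count P? (a ∷ b ∷ v) ≡ count P? (b ∷ a ∷ v)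
  count-swap a b v with does (P? a) | does (P? b)
  ... | true  | true  = refl
  ... | true  | false = refl
  ... | false | true  = refl
  ... | false | false = refl

  count-none : {v : Vec A m} → All (λ z → ¬ P z) v → count P? v ≡ 0
  count-none {v = []}    []         = refl
  count-none {v = a ∷ v} (¬pa ∷ ¬ps) with P? a
  ... | yes pa = contradiction pa ¬pa
  ... | no  _  = count-none ¬ps

  count-pair-one : ∀ {u v} → (P u × ¬ P v) ⊎ (¬ P u × P v) → count P? (u ∷ v ∷ []) ≡ 1
  count-pair-one {u} {v} (inj₁ (pu , ¬pv)) rewrite dec-true (P? u) pu | dec-false (P? v) ¬pv = refl
  count-pair-one {u} {v} (inj₂ (¬pu , pv)) rewrite dec-false (P? u) ¬pu | dec-true (P? v) pv = refl

module _ {p} {P : Pred ℤ p} (P? : Decidable P) where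

  count-insert : ∀ a (v : Vec ℤ m) → count P? (insert a v) ≡ count P? (a ∷ v)
  count-insert a []      = refl
  count-insert a (b ∷ v) with a ℤ.≤? b
  ... | yes _ = refl
  ... | no  _ = trans (cong (if does (P? b) then suc else id) (count-insert a v)) (count-swap P? b a v)

  count-sort : (v : Vec ℤ m) → count P? (sort v) ≡ count P? v
  count-sort []      = refl
  count-sort (a ∷ v) =
    trans (count-insert a (sort v)) (cong (if does (P? a) then suc else id) (count-sort v))

Sorted : Vec ℤ m → Set
Sorted = AllPairs ℤ._≤_

insert-all : ∀ {p} {P : Pred ℤ p} {a} {v : Vec ℤ m} → P a → All P v → All P (insert a v)
insert-all {v = []}            pa []         = pa ∷ []
insert-all {a = a} {v = b ∷ v} pa (pb ∷ ps) with a ℤ.≤? b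
... | yes _ = pa ∷ pb ∷ ps
... | no  _ = pb ∷ insert-all pa ps

insert-sorted : ∀ a {v : Vec ℤ m} → Sorted v → Sorted (insert a v)
insert-sorted a []                     = [] ∷ []
insert-sorted a {b ∷ v} (b≤v ∷ sorted) with a ℤ.≤? b
... | yes a≤b = (a≤b ∷ All.map (ℤP.≤-trans a≤b) b≤v) ∷ b≤v ∷ sorted
... | no  a≰b = insert-all (ℤP.<⇒≤ (ℤP.≰⇒> a≰b)) b≤v ∷ insert-sorted a sorted

sort-sorted : (v : Vec ℤ m) → Sorted (sort v)
sort-sorted []      = []
sort-sorted (a ∷ v) = insert-sorted a (sort-sorted v)

module _ (y : ℤ) where

  sorted-lookup-< : {s : Vec ℤ m} → Sorted s → (k : Fin m) →
                    toℕ k < count (ℤ._<? y) s → lookup s k ℤ.< y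
  sorted-lookup-< {s = a ∷ s} (a≤s ∷ sorted) k k<c with a ℤ.<? y | k
  ... | yes a<y | zero  = a<y
  ... | yes _   | suc k = sorted-lookup-< sorted k (s≤s⁻¹ k<c)
  ... | no  a≮y | k     = contradiction (subst (toℕ k <_) (count-none (ℤ._<? y) s≮y) k<c) ℕP.n≮0
    where s≮y = All.map (λ a≤z z<y → a≮y (ℤP.≤-<-trans a≤z z<y)) a≤s

  sorted-lookup-≥ : {s : Vec ℤ m} → Sorted s → (k : Fin m) →
                    count (ℤ._<? y) s ≤ toℕ k → y ℤ.≤ lookup s k
  sorted-lookup-≥ {s = a ∷ s} (a≤s ∷ sorted) k c≤k with a ℤ.<? y | k
  sorted-lookup-≥ (a≤s ∷ sorted) _ () | yes _ | zero
  ... | yes _   | suc k = sorted-lookup-≥ sorted k (s≤s⁻¹ c≤k)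
  ... | no  a≮y | zero  = ℤP.≮⇒≥ a≮y
  ... | no  a≮y | suc k = ℤP.≤-trans (ℤP.≮⇒≥ a≮y) (All.lookup⁺ a≤s k)

kthSmallest-< : ∀ y (v : Vec ℤ m) (k : Fin m) → toℕ k < count (ℤ._<? y) v → kthSmallest v k ℤ.< y
kthSmallest-< y v k k<c =
  sorted-lookup-< y (sort-sorted v) k (subst (toℕ k <_) (sym (count-sort (ℤ._<? y) v)) k<c)

kthSmallest-≥ : ∀ y (v : Vec ℤ m) (k : Fin m) → count (ℤ._<? y) v ≤ toℕ k → y ℤ.≤ kthSmallest v k
kthSmallest-≥ y v k c≤k =
  sorted-lookup-≥ y (sort-sorted v) k (subst (_≤ toℕ k) (sym (count-sort (ℤ._<? y) v)) c≤k)

kthSmallest-separated : ∀ y (u v : Vec ℤ m) k →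
                        toℕ k < count (ℤ._<? y) u → count (ℤ._<? y) v ≤ toℕ k →
                        kthSmallest u k ℤ.< kthSmallest v k
kthSmallest-separated y u v k k<cu cv≤k =
  ℤP.<-≤-trans (kthSmallest-< y u k k<cu) (kthSmallest-≥ y v k cv≤k)

-- Polynomial bounds

module _ where

  open import Data.Nat.Properties
  open import Data.Nat.Tactic.RingSolver using (solve-∀)

  -- Equivalent to PolyBounded, but closed under sums and products without rescaling.
  PowerBounded : (ℕ → ℕ) → Set
  PowerBounded g = ∃₂ λ K d → (n : ℕ) → g n ≤ K * suc n ^ d

  ^-distribʳ-* : ∀ a b d → (a * b) ^ d ≡ a ^ d * b ^ d
  ^-distribʳ-* a b zero    = refl
  ^-distribʳ-* a b (suc d) =
    trans (cong (a * b *_) (^-distribʳ-* a b d)) (interchange a b (a ^ d) (b ^ d))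
    where
    interchange : ∀ a b x y → a * b * (x * y) ≡ a * x * (b * y)
    interchange = solve-∀

  polyBounded⇒powerBounded : ∀ {g} → PolyBounded g → PowerBounded g
  polyBounded⇒powerBounded (c , bound) = c + c , c , λ n → ≤-trans (bound n) (begin
    c * n ^ c + c                 ≤⟨ +-monoˡ-≤ c (*-monoʳ-≤ c (^-monoˡ-≤ c (n≤1+n n))) ⟩
    c * suc n ^ c + c             ≤⟨ +-monoʳ-≤ (c * suc n ^ c) (m≤m*n c (suc n ^ c) {{m^n≢0 (suc n) c}}) ⟩
    c * suc n ^ c + c * suc n ^ c ≡⟨ *-distribʳ-+ (suc n ^ c) c c ⟨
    (c + c) * suc n ^ c           ∎)
    where open ≤-Reasoning

  powerBounded⇒polyBounded : ∀ {g} → PowerBounded g → PolyBounded g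
  powerBounded⇒polyBounded {g} (K , d , bound) = c , bound′
    where
    c = K * 2 ^ d + d
    bound′ : (n : ℕ) → g n ≤ c * n ^ c + c
    bound′ zero = begin
      g 0               ≤⟨ bound 0 ⟩
      K * 1 ^ d         ≡⟨ cong (K *_) (^-zeroˡ d) ⟩
      K * 1             ≤⟨ *-monoʳ-≤ K (m^n>0 2 d) ⟩
      K * 2 ^ d         ≤⟨ m≤m+n (K * 2 ^ d) d ⟩
      c                 ≤⟨ m≤n+m c (c * 0 ^ c) ⟩
      c * 0 ^ c + c     ∎
      where open ≤-Reasoning
    bound′ n@(suc m) = begin
      g n                  ≤⟨ bound n ⟩
      K * suc n ^ d        ≤⟨ *-monoʳ-≤ K (^-monoˡ-≤ d (s≤s (m≤n+m n m))) ⟩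
      K * (n + n) ^ d      ≡⟨ cong (λ z → K * (n + z) ^ d) (+-identityʳ n) ⟨
      K * (2 * n) ^ d      ≡⟨ cong (K *_) (^-distribʳ-* 2 n d) ⟩
      K * (2 ^ d * n ^ d)  ≡⟨ *-assoc K (2 ^ d) _ ⟨
      K * 2 ^ d * n ^ d    ≤⟨ *-mono-≤ (m≤m+n (K * 2 ^ d) d) (^-monoʳ-≤ n (m≤n+m d (K * 2 ^ d))) ⟩
      c * n ^ c            ≤⟨ m≤m+n _ c ⟩
      c * n ^ c + c        ∎
      where open ≤-Reasoning

  powerBounded-mono : ∀ {g h} → (∀ n → g n ≤ h n) → PowerBounded h → PowerBounded g
  powerBounded-mono g≤h (K , d , bound) = K , d , λ n → ≤-trans (g≤h n) (bound n)

  powerBounded-const : ∀ a → PowerBounded (λ _ → a)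
  powerBounded-const a = a , 0 , λ n → ≤-reflexive (sym (*-identityʳ a))

  powerBounded-id : PowerBounded (λ n → n)
  powerBounded-id = 1 , 1 , λ n → ≤-trans (n≤1+n n) (≤-reflexive (sym (trans (*-identityˡ _) (*-identityʳ _))))

  powerBounded-+ : ∀ {g h} → PowerBounded g → PowerBounded h → PowerBounded (λ n → g n + h n)
  powerBounded-+ {g} {h} (K₁ , d₁ , bound₁) (K₂ , d₂ , bound₂) = K₁ + K₂ , d₁ + d₂ , λ n → begin
    g n + h n                                       ≤⟨ +-mono-≤ (raise g K₁ bound₁ (m≤m+n d₁ d₂) n)
                                                                (raise h K₂ bound₂ (m≤n+m d₂ d₁) n) ⟩
    K₁ * suc n ^ (d₁ + d₂) + K₂ * suc n ^ (d₁ + d₂) ≡⟨ *-distribʳ-+ _ K₁ K₂ ⟨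
    (K₁ + K₂) * suc n ^ (d₁ + d₂)                   ∎
    where
    open ≤-Reasoning
    raise : ∀ f K {d e} → (∀ n → f n ≤ K * suc n ^ d) → d ≤ e → ∀ n → f n ≤ K * suc n ^ e
    raise f K bound d≤e n = ≤-trans (bound n) (*-monoʳ-≤ K (^-monoʳ-≤ (suc n) d≤e))

  powerBounded-* : ∀ {g h} → PowerBounded g → PowerBounded h → PowerBounded (λ n → g n * h n)
  powerBounded-* {g} {h} (K₁ , d₁ , bound₁) (K₂ , d₂ , bound₂) = K₁ * K₂ , d₁ + d₂ , λ n → begin
    g n * h n                           ≤⟨ *-mono-≤ (bound₁ n) (bound₂ n) ⟩
    K₁ * suc n ^ d₁ * (K₂ * suc n ^ d₂) ≡⟨ interchange K₁ K₂ (suc n ^ d₁) (suc n ^ d₂) ⟩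
    K₁ * K₂ * (suc n ^ d₁ * suc n ^ d₂) ≡⟨ cong (K₁ * K₂ *_) (^-distribˡ-+-* (suc n) d₁ d₂) ⟨
    K₁ * K₂ * suc n ^ (d₁ + d₂)         ∎
    where
    open ≤-Reasoning
    interchange : ∀ a b x y → a * x * (b * y) ≡ a * b * (x * y)
    interchange = solve-∀

dot-replicate-0 : (x : Vec Bool n) → dot (replicate n 0ℤ) x ≡ 0ℤ
dot-replicate-0 []      = refl
dot-replicate-0 (b ∷ x) =
  trans (cong (ℤ._+_ (0ℤ ℤ.* bit b)) (dot-replicate-0 x)) (ℤP.+-identityʳ (0ℤ ℤ.* bit b))

dot-map-* : ∀ k (w : Vec ℤ n) (x : Vec Bool n) → dot (map (k ℤ.*_) w) x ≡ k ℤ.* dot w x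
dot-map-* k []      []      = sym (ℤP.*-zeroʳ k)
dot-map-* k (a ∷ w) (b ∷ x) =
  trans (cong (ℤ._+_ (k ℤ.* a ℤ.* bit b)) (dot-map-* k w x)) (distrib k a (bit b) (dot w x))
  where
  distrib : ∀ k a b d → k ℤ.* a ℤ.* b ℤ.+ k ℤ.* d ≡ k ℤ.* (a ℤ.* b ℤ.+ d)
  distrib = ℤ-RingSolver.solve-∀

∣dot∣≤ : (w : Vec ℤ n) (x : Vec Bool n) → ∣ dot w x ∣ ≤ n * maxAbs w
∣dot∣≤         []      []      = z≤n
∣dot∣≤ {suc n} (a ∷ w) (b ∷ x) = ℕP.≤-trans (ℤP.∣i+j∣≤∣i∣+∣j∣ (a ℤ.* bit b) (dot w x))
  (ℕP.+-mono-≤ (ℕP.≤-trans (∣a*bit∣≤ b) (ℕP.m≤m⊔n ∣ a ∣ (maxAbs w)))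
               (ℕP.≤-trans (∣dot∣≤ w x) (ℕP.*-monoʳ-≤ n (ℕP.m≤n⊔m ∣ a ∣ (maxAbs w)))))
  where
  ∣a*bit∣≤ : ∀ b → ∣ a ℤ.* bit b ∣ ≤ ∣ a ∣
  ∣a*bit∣≤ true  rewrite ℤP.*-identityʳ a = ℕP.≤-refl
  ∣a*bit∣≤ false rewrite ℤP.*-zeroʳ a     = z≤n

maxAbs-replicate-0 : ∀ n → maxAbs (replicate n 0ℤ) ≡ 0
maxAbs-replicate-0 zero    = refl
maxAbs-replicate-0 (suc n) = maxAbs-replicate-0 n

maxAbs-map-* : ∀ k (w : Vec ℤ n) → maxAbs (map (k ℤ.*_) w) ≤ ∣ k ∣ * maxAbs w
maxAbs-map-* k []      = z≤n
maxAbs-map-* k (a ∷ w) = ℕP.⊔-lub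
  (ℕP.≤-trans (ℕP.≤-reflexive (ℤP.abs-* k a)) (ℕP.*-monoʳ-≤ ∣ k ∣ (ℕP.m≤m⊔n ∣ a ∣ (maxAbs w))))
  (ℕP.≤-trans (maxAbs-map-* k w) (ℕP.*-monoʳ-≤ ∣ k ∣ (ℕP.m≤n⊔m ∣ a ∣ (maxAbs w))))

+K≤+K*+[1+n] : ∀ K n → + K ℤ.≤ + K ℤ.* + suc n
+K≤+K*+[1+n] K n = subst (+ K ℤ.≤_) (ℤP.pos-* K (suc n)) (ℤ.+≤+ (ℕP.m≤m*n K (suc n)))

multiple-far-from-0 : ∀ K (g : ℤ) → g ≢ 0ℤ → + K ℤ.≤ + K ℤ.* g ⊎ + K ℤ.* g ℤ.≤ ℤ.- + K
multiple-far-from-0 K (+ zero)  g≢0 = contradiction refl g≢0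
multiple-far-from-0 K (+ suc n) _   = inj₁ (+K≤+K*+[1+n] K n)
multiple-far-from-0 K -[1+ n ]  _   = inj₂ (subst (ℤ._≤ ℤ.- + K) (ℤP.neg-distribʳ-* (+ K) (+ suc n))
                                         (ℤP.neg-mono-≤ (+K≤+K*+[1+n] K n)))

far-pair-count : ∀ {K t Y} u → t < K → 1 ≤ Y → Y ≤ K → + K ℤ.≤ u ⊎ u ℤ.≤ ℤ.- + K →
                 count (ℤ._<? + Y) (+ t ℤ.+ u ∷ + K ℤ.- u ∷ []) ≡ 1
far-pair-count {K} {t} {Y} u t<K 1≤Y Y≤K (inj₁ K≤u) =
  count-pair-one (ℤ._<? + Y) (inj₂ (¬low<Y , high<Y))
  where
  ¬low<Y : ¬ (+ t ℤ.+ u ℤ.< + Y)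
  ¬low<Y = ℤP.≤⇒≯ (ℤP.≤-trans (ℤ.+≤+ Y≤K) (ℤP.≤-trans K≤u (ℤP.i≤j+i u (+ t))))
  high<Y : + K ℤ.- u ℤ.< + Y
  high<Y = ℤP.≤-<-trans (ℤP.i≤j⇒i-j≤0 K≤u) (ℤ.+<+ 1≤Y)
far-pair-count {K} {t} {Y} u t<K 1≤Y Y≤K (inj₂ u≤-K) =
  count-pair-one (ℤ._<? + Y) (inj₁ (low<Y , ¬high<Y))
  where
  open ℤP.≤-Reasoning
  low<Y : + t ℤ.+ u ℤ.< + Y
  low<Y = begin-strict
    + t ℤ.+ u     <⟨ ℤP.+-monoˡ-< u (ℤ.+<+ t<K) ⟩
    + K ℤ.+ u     ≤⟨ ℤP.+-monoʳ-≤ (+ K) u≤-K ⟩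
    + K ℤ.- + K   ≡⟨ ℤP.+-inverseʳ (+ K) ⟩
    0ℤ            <⟨ ℤ.+<+ 1≤Y ⟩
    + Y           ∎
  K≤-u : + K ℤ.≤ ℤ.- u
  K≤-u = subst (ℤ._≤ ℤ.- u) (ℤP.neg-involutive (+ K)) (ℤP.neg-mono-≤ u≤-K)
  ¬high<Y : ¬ (+ K ℤ.- u ℤ.< + Y)
  ¬high<Y = ℤP.≤⇒≯ (begin
    + Y           ≤⟨ ℤ.+≤+ Y≤K ⟩
    + K           ≡⟨ ℤP.+-identityʳ (+ K) ⟨
    + K ℤ.+ 0ℤ    ≤⟨ ℤP.+-monoʳ-≤ (+ K) (ℤP.≤-trans (ℤ.+≤+ z≤n) K≤-u) ⟩
    + K ℤ.- u     ∎)

-- The construction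

constant : ∀ n → ℤ → Affine n
constant n c = affine (replicate n 0ℤ) c

gap : ExactThreshold n → Vec Bool n → ℤ
gap (exactThr w θ) x = dot w x ℤ.- θ

gadget : ℕ → ℕ → ExactThreshold n → Vec (Affine n) 2
gadget K t (exactThr w θ) = affine (map (+ K ℤ.*_) w) (+ t ℤ.- + K ℤ.* θ)
                          ∷ affine (map (ℤ.- + K ℤ.*_) w) (+ K ℤ.+ + K ℤ.* θ) ∷ []

blank : ℕ → Vec (Affine n) 2
blank {n} K = constant n 0ℤ ∷ constant n (+ suc K) ∷ []

reachable : ExactThreshold n → Bool
reachable {n} (exactThr w θ) = does (∣ θ ∣ ≤? n * maxAbs w)

reachable⇒θ≤ : ∀ (w : Vec ℤ n) θ → reachable (exactThr w θ) ≡ true → ∣ θ ∣ ≤ n * maxAbs w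
reachable⇒θ≤ {n} w θ r = ℕP.≤ᵇ⇒≤ ∣ θ ∣ (n * maxAbs w) (subst T (sym r) tt)

pairFor : Bool → ℕ → ℕ → ExactThreshold n × Bool → Vec (Affine n) 2
pairFor s K t (f , c) = if reachable f ∧ does (c Bool.≟ s) then gadget K t f else blank K

forms : ℕ → Bool → (l : ELDL n) → Vec (Affine n) (length l * 2)
forms K s []ᴸ      = []
forms K s (i ∷ᴸ l) = pairFor s K (suc (length l)) i ++ forms K s l

alwaysFires : ExactThreshold n
alwaysFires {n} = exactThr (replicate n 0ℤ) 0ℤ

withDefault : ELDL n → ELDL n
withDefault D = D ++ᴸ [ alwaysFires , false ]

length-withDefault : (D : ELDL n) → length (withDefault D) ≡ suc (length D)
length-withDefault D = trans (length-++ D) (ℕP.+-comm (length D) 1)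

mismatch : Bool → Bool → ℕ
mismatch s c = if does (c Bool.≟ s) then 0 else 1

scale : ELDL n → ℕ
scale D = suc (suc (length D))

medianIndex : (D : ELDL n) → Fin (length (withDefault D) * 2)
medianIndex D = fromℕ< (subst (λ l → length D < l * 2) (sym (length-withDefault D))
                              (s≤s (ℕP.m≤n⇒m≤1+n (ℕP.m≤m*n (length D) 2))))

toKSTAT : ELDL n → KSTAT n
toKSTAT D = kstat _ _ (forms (scale D) false (withDefault D)) (forms (scale D) true (withDefault D))
                      (medianIndex D) (medianIndex D)

-- Counting the values below the tag of the first firing instruction

module _ (x : Vec Bool n) where

  values : Vec (Affine n) m → Vec ℤ m
  values = map (λ A → evalAffine A x)

  below : ℕ → Vec (Affine n) m → ℕ
  below Y As = count (ℤ._<? + Y) (values As)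

  alwaysFires-fires : evalET alwaysFires x ≡ true
  alwaysFires-fires = dec-true (dot (replicate n 0ℤ) x ℤ.≟ 0ℤ) (dot-replicate-0 x)

  fires⇒gap≡0 : (f : ExactThreshold n) → evalET f x ≡ true → gap f x ≡ 0ℤ
  fires⇒gap≡0 (exactThr w θ) e with dot w x ℤ.≟ θ
  fires⇒gap≡0 (exactThr w θ) e  | yes refl = ℤP.+-inverseʳ (dot w x)
  fires⇒gap≡0 (exactThr w θ) () | no  _

  silent⇒gap≢0 : (f : ExactThreshold n) → evalET f x ≡ false → gap f x ≢ 0ℤ
  silent⇒gap≢0 (exactThr w θ) e with dot w x ℤ.≟ θ
  silent⇒gap≢0 (exactThr w θ) () | yes _
  silent⇒gap≢0 (exactThr w θ) e  | no  d≢θ = d≢θ ∘′ ℤP.i-j≡0⇒i≡j (dot w x) θ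

  fires⇒reachable : (f : ExactThreshold n) → evalET f x ≡ true → reachable f ≡ true
  fires⇒reachable (exactThr w θ) e with dot w x ℤ.≟ θ
  fires⇒reachable (exactThr w θ) e  | yes refl = dec-true (∣ dot w x ∣ ≤? n * maxAbs w) (∣dot∣≤ w x)
  fires⇒reachable (exactThr w θ) () | no  _

  evalAffine-constant : ∀ c → evalAffine (constant n c) x ≡ c
  evalAffine-constant c = trans (cong (ℤ._+ c) (dot-replicate-0 x)) (ℤP.+-identityˡ c)

  values-gadget : ∀ K t (f : ExactThreshold n) →
                  values (gadget K t f) ≡ (+ t ℤ.+ + K ℤ.* gap f x) ∷ (+ K ℤ.- + K ℤ.* gap f x) ∷ []
  values-gadget K t (exactThr w θ) = cong₂ (λ a b → a ∷ b ∷ [])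
    (trans (cong (ℤ._+ (+ t ℤ.- + K ℤ.* θ)) (dot-map-* (+ K) w x)) (low (+ K) (+ t) (dot w x) θ))
    (trans (cong (ℤ._+ (+ K ℤ.+ + K ℤ.* θ)) (dot-map-* (ℤ.- + K) w x)) (high (+ K) (dot w x) θ))
    where
    low : ∀ k t d θ → k ℤ.* d ℤ.+ (t ℤ.- k ℤ.* θ) ≡ t ℤ.+ k ℤ.* (d ℤ.- θ)
    low = ℤ-RingSolver.solve-∀
    high : ∀ k d θ → ℤ.- k ℤ.* d ℤ.+ (k ℤ.+ k ℤ.* θ) ≡ k ℤ.- k ℤ.* (d ℤ.- θ)
    high = ℤ-RingSolver.solve-∀

  values-gadget-fired : ∀ {K t} (f : ExactThreshold n) → evalET f x ≡ true →
                        values (gadget K t f) ≡ + t ∷ + K ∷ []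
  values-gadget-fired {K} {t} f e rewrite values-gadget K t f | fires⇒gap≡0 f e | ℤP.*-zeroʳ (+ K) =
    cong₂ (λ a b → a ∷ b ∷ []) (ℤP.+-identityʳ (+ t)) (ℤP.+-identityʳ (+ K))

  below-++ : ∀ Y {m₁ m₂} (As : Vec (Affine n) m₁) (Bs : Vec (Affine n) m₂) →
             below Y (As ++ Bs) ≡ below Y As + below Y Bs
  below-++ Y As Bs = trans (cong (count (ℤ._<? + Y)) (map-++ _ As Bs))
                           (count-++ (ℤ._<? + Y) (values As) (values Bs))

  below-forms-∷ : ∀ {K} Y s i (l : ELDL n) →
                  below Y (forms K s (i ∷ᴸ l)) ≡ below Y (pairFor s K (suc (length l)) i) + below Y (forms K s l)
  below-forms-∷ {K} Y s i l = below-++ Y (pairFor s K (suc (length l)) i) (forms K s l)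

  below-blank : ∀ {K Y} → 1 ≤ Y → Y ≤ K → below Y (blank K) ≡ 1
  below-blank {K} {Y} 1≤Y Y≤K rewrite evalAffine-constant 0ℤ | evalAffine-constant (+ suc K) =
    count-pair-one (ℤ._<? + Y) (inj₁ (ℤ.+<+ 1≤Y , ℤP.≤⇒≯ (ℤ.+≤+ (ℕP.m≤n⇒m≤1+n Y≤K))))

  below-pair-silent : ∀ {K t Y} s (f : ExactThreshold n) c → evalET f x ≡ false →
                      t < K → 1 ≤ Y → Y ≤ K → below Y (pairFor s K t (f , c)) ≡ 1
  below-pair-silent {K} {t} {Y} s f c e t<K 1≤Y Y≤K with reachable f ∧ does (c Bool.≟ s)
  ... | true  = trans (cong (count (ℤ._<? + Y)) (values-gadget K t f))
                      (far-pair-count _ t<K 1≤Y Y≤K (multiple-far-from-0 K (gap f x) (silent⇒gap≢0 f e)))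
  ... | false = below-blank 1≤Y Y≤K

  below-pair-late : ∀ {K t Y} s (f : ExactThreshold n) c → evalET f x ≡ true →
                    t < Y → Y ≤ K → below Y (pairFor s K t (f , c)) ≡ 1
  below-pair-late {K} {t} {Y} s f c e t<Y Y≤K with reachable f ∧ does (c Bool.≟ s)
  ... | true  = trans (cong (count (ℤ._<? + Y)) (values-gadget-fired f e))
                      (count-pair-one (ℤ._<? + Y) (inj₁ (ℤ.+<+ t<Y , ℤP.≤⇒≯ (ℤ.+≤+ Y≤K))))
  ... | false = below-blank (ℕP.≤-<-trans z≤n t<Y) Y≤K

  below-pair-at : ∀ {K t} s (f : ExactThreshold n) c → evalET f x ≡ true →
                  1 ≤ t → t ≤ K → below t (pairFor s K t (f , c)) ≡ mismatch s c
  below-pair-at {K} {t} s f c e 1≤t t≤K rewrite fires⇒reachable f e with does (c Bool.≟ s)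
  ... | true  = trans (cong (count (ℤ._<? + t)) (values-gadget-fired f e))
                      (count-none (ℤ._<? + t) (ℤP.<-irrefl refl ∷ ℤP.≤⇒≯ (ℤ.+≤+ t≤K) ∷ []))
  ... | false = below-blank 1≤t t≤K

  below-tail : ∀ {K Y} s (l : ELDL n) → length l < Y → Y ≤ K → below Y (forms K s l) ≡ length l
  below-tail         s []ᴸ            _   _   = refl
  below-tail {K} {Y} s ((f , c) ∷ᴸ l) l<Y Y≤K =
    trans (below-forms-∷ Y s (f , c) l) (cong₂ _+_ head (below-tail s l (ℕP.<-trans (ℕP.n<1+n _) l<Y) Y≤K))
    where
    head : below Y (pairFor s K (suc (length l)) (f , c)) ≡ 1
    head with evalET f x in e
    ... | true  = below-pair-late s f c e l<Y Y≤K
    ... | false = below-pair-silent s f c e (ℕP.<-≤-trans l<Y Y≤K) (ℕP.≤-<-trans z≤n l<Y) Y≤K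

  below-firstFired : ∀ {K} s (f : ExactThreshold n) c (l : ELDL n) → evalET f x ≡ true → length l < K →
                     below (suc (length l)) (forms K s ((f , c) ∷ᴸ l)) ≡ length l + mismatch s c
  below-firstFired {K} s f c l e l<K = begin
    below t (forms K s ((f , c) ∷ᴸ l))
      ≡⟨ below-forms-∷ t s (f , c) l ⟩
    below t (pairFor s K t (f , c)) + below t (forms K s l)
      ≡⟨ cong₂ _+_ (below-pair-at s f c e (s≤s z≤n) l<K) (below-tail s l ℕP.≤-refl l<K) ⟩
    mismatch s c + length l
      ≡⟨ ℕP.+-comm (mismatch s c) (length l) ⟩
    length l + mismatch s c
      ∎
    where
    open ≡-Reasoning
    t : ℕ
    t = suc (length l)

  -- suc (firingRank l) is the tag of the first instruction of l that fires.
  firingRank : ELDL n → ℕ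
  firingRank []ᴸ            = 0
  firingRank ((f , c) ∷ᴸ l) = if evalET f x then length l else firingRank l

  firingRank-withDefault : (D : ELDL n) → firingRank (withDefault D) < length (withDefault D)
  firingRank-withDefault []ᴸ rewrite alwaysFires-fires = s≤s z≤n
  firingRank-withDefault ((f , c) ∷ᴸ D) with evalET f x
  ... | true  = ℕP.n<1+n _
  ... | false = ℕP.m<n⇒m<1+n (firingRank-withDefault D)

  below-withDefault : ∀ {K} s (D : ELDL n) → length (withDefault D) < K →
                      below (suc (firingRank (withDefault D))) (forms K s (withDefault D))
                        ≡ length D + mismatch s (evalELDL D x)
  below-withDefault s []ᴸ 1<K rewrite alwaysFires-fires =
    below-firstFired s alwaysFires false []ᴸ alwaysFires-fires (ℕP.≤-<-trans z≤n 1<K)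
  below-withDefault {K} s ((f , c) ∷ᴸ D) t<K with evalET f x in e
  ... | true  = trans (below-firstFired s f c (withDefault D) e l<K)
                      (cong (_+ mismatch s c) (length-withDefault D))
    where
    l<K : length (withDefault D) < K
    l<K = ℕP.<-trans (ℕP.n<1+n _) t<K
  ... | false = trans (below-forms-∷ Y s (f , c) (withDefault D))
                      (cong₂ _+_ (below-pair-silent s f c e t<K (s≤s z≤n) (ℕP.<⇒≤ Y<K))
                                 (below-withDefault s D l<K))
    where
    Y : ℕ
    Y = suc (firingRank (withDefault D))
    l<K : length (withDefault D) < K
    l<K = ℕP.<-trans (ℕP.n<1+n _) t<K
    Y<K : Y < K
    Y<K = ℕP.≤-<-trans (firingRank-withDefault D) l<K

length-withDefault<scale : (D : ELDL n) → length (withDefault D) < scale D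
length-withDefault<scale D = s≤s (ℕP.≤-reflexive (length-withDefault D))

toKSTAT-correct : (D : ELDL n) (x : Vec Bool n) → evalKSTAT (toKSTAT D) x ≡ evalELDL D x
toKSTAT-correct D x = decide (evalELDL D x) (below-withDefault x false D (length-withDefault<scale D))
                                            (below-withDefault x true  D (length-withDefault<scale D))
  where
  len : ℕ
  len = length D
  Y : ℤ
  Y = + suc (firingRank x (withDefault D))
  k : Fin (length (withDefault D) * 2)
  k = medianIndex D
  vL vR : Vec ℤ (length (withDefault D) * 2)
  vL = values x (forms (scale D) false (withDefault D))
  vR = values x (forms (scale D) true (withDefault D))
  k≡len : toℕ k ≡ len
  k≡len = toℕ-fromℕ< _
  k<len+1 : toℕ k < len + 1
  k<len+1 = subst₂ _<_ (sym k≡len) (ℕP.+-comm 1 len) ℕP.≤-refl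
  len+0≤k : len + 0 ≤ toℕ k
  len+0≤k = ℕP.≤-reflexive (trans (ℕP.+-identityʳ len) (sym k≡len))
  decide : ∀ b → count (ℤ._<? Y) vL ≡ len + mismatch false b → count (ℤ._<? Y) vR ≡ len + mismatch true b →
           evalKSTAT (toKSTAT D) x ≡ b
  decide true  cL cR = dec-true (kthSmallest vL k ℤ.<? kthSmallest vR k)
    (kthSmallest-separated Y vL vR k (subst (toℕ k <_) (sym cL) k<len+1) (subst (_≤ toℕ k) (sym cR) len+0≤k))
  decide false cL cR = dec-false (kthSmallest vL k ℤ.<? kthSmallest vR k) (ℤP.<-asym
    (kthSmallest-separated Y vR vL k (subst (toℕ k <_) (sym cR) k<len+1) (subst (_≤ toℕ k) (sym cL) len+0≤k)))

-- Coefficient bounds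

maxCoeffs-≤ : ∀ {B} {As : Vec (Affine n) m} → All (λ A → maxCoeffAffine A ≤ B) As → maxCoeffs As ≤ B
maxCoeffs-≤ []         = z≤n
maxCoeffs-≤ (A≤ ∷ As≤) = ℕP.⊔-lub A≤ (maxCoeffs-≤ As≤)

maxWeight-withDefault : (D : ELDL n) → maxWeightELDL (withDefault D) ≤ maxWeightELDL D
maxWeight-withDefault {n} []ᴸ rewrite maxAbs-replicate-0 n = z≤n
maxWeight-withDefault ((exactThr w θ , c) ∷ᴸ D) = ℕP.⊔-monoʳ-≤ (maxAbs w) (maxWeight-withDefault D)

coeffBound : ℕ → ℕ → ℕ → ℕ
coeffBound K n W = suc (K + K * (n * W) + K * W)

module _ {K W : ℕ} where

  CoeffBounded : Affine n → Set
  CoeffBounded {n} A = maxCoeffAffine A ≤ coeffBound K n W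

  affine-bounded : ∀ (a : Vec ℤ n) b → maxAbs a ≤ K * W → ∣ b ∣ ≤ K + K * (n * W) → CoeffBounded (affine a b)
  affine-bounded {n} _ _ a≤ b≤ = ℕP.⊔-lub
    (ℕP.≤-trans a≤ (ℕP.m≤n⇒m≤1+n (ℕP.m≤n+m (K * W) (K + K * (n * W)))))
    (ℕP.≤-trans b≤ (ℕP.m≤n⇒m≤1+n (ℕP.m≤m+n (K + K * (n * W)) (K * W))))

  constant-bounded : ∀ n c → ∣ c ∣ ≤ coeffBound K n W → CoeffBounded (constant n c)
  constant-bounded n _ c≤ = ℕP.⊔-lub (ℕP.≤-trans (ℕP.≤-reflexive (maxAbs-replicate-0 n)) z≤n) c≤

  blank-bounded : All CoeffBounded (blank {n} K)
  blank-bounded {n} = constant-bounded n 0ℤ z≤n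
                    ∷ constant-bounded n (+ suc K) (s≤s (ℕP.≤-trans (ℕP.m≤m+n K _) (ℕP.m≤m+n _ (K * W))))
                    ∷ []

  gadget-bounded : ∀ {t} (w : Vec ℤ n) θ → t ≤ K → ∣ θ ∣ ≤ n * maxAbs w → maxAbs w ≤ W →
                   All CoeffBounded (gadget K t (exactThr w θ))
  gadget-bounded {n} {t} w θ t≤K θ≤ w≤W =
      affine-bounded (map (+ K ℤ.*_) w) (+ t ℤ.- + K ℤ.* θ) (weights (+ K) refl)
                     (ℕP.≤-trans (ℤP.∣i-j∣≤∣i∣+∣j∣ (+ t) (+ K ℤ.* θ)) (ℕP.+-mono-≤ t≤K ∣Kθ∣≤))
    ∷ affine-bounded (map (ℤ.- + K ℤ.*_) w) (+ K ℤ.+ + K ℤ.* θ) (weights (ℤ.- + K) (ℤP.∣-i∣≡∣i∣ (+ K)))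
                     (ℕP.≤-trans (ℤP.∣i+j∣≤∣i∣+∣j∣ (+ K) (+ K ℤ.* θ)) (ℕP.+-monoʳ-≤ K ∣Kθ∣≤))
    ∷ []
    where
    weights : ∀ k → ∣ k ∣ ≡ K → maxAbs (map (k ℤ.*_) w) ≤ K * W
    weights k ∣k∣≡K = ℕP.≤-trans (maxAbs-map-* k w)
      (subst (λ c → c * maxAbs w ≤ K * W) (sym ∣k∣≡K) (ℕP.*-monoʳ-≤ K w≤W))
    ∣Kθ∣≤ : ∣ + K ℤ.* θ ∣ ≤ K * (n * W)
    ∣Kθ∣≤ = ℕP.≤-trans (ℕP.≤-reflexive (ℤP.abs-* (+ K) θ)) (ℕP.*-monoʳ-≤ K (ℕP.≤-trans θ≤ (ℕP.*-monoʳ-≤ n w≤W)))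

  pairFor-bounded : ∀ {t} s (w : Vec ℤ n) θ c → t ≤ K → maxAbs w ≤ W →
                    All CoeffBounded (pairFor s K t (exactThr w θ , c))
  pairFor-bounded {n} s w θ c t≤K w≤W with reachable (exactThr w θ) in r | does (c Bool.≟ s)
  ... | true  | true  = gadget-bounded w θ t≤K (reachable⇒θ≤ w θ r) w≤W
  ... | true  | false = blank-bounded
  ... | false | _     = blank-bounded

  forms-bounded : ∀ s (l : ELDL n) → length l < K → maxWeightELDL l ≤ W → All CoeffBounded (forms K s l)
  forms-bounded s []ᴸ                       _   _   = []
  forms-bounded s ((exactThr w θ , c) ∷ᴸ l) l<K l≤W = All.++⁺
    (pairFor-bounded s w θ c (ℕP.<⇒≤ l<K) (ℕP.≤-trans (ℕP.m≤m⊔n (maxAbs w) _) l≤W))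
    (forms-bounded s l (ℕP.<-trans (ℕP.n<1+n _) l<K) (ℕP.≤-trans (ℕP.m≤n⊔m (maxAbs w) _) l≤W))

toKSTAT-size : (D : ELDL n) → sizeKSTAT (toKSTAT D) ≡ suc (length D) * 2 + suc (length D) * 2
toKSTAT-size D = cong (λ l → l * 2 + l * 2) (length-withDefault D)

toKSTAT-maxCoeff : (D : ELDL n) → maxCoeffKSTAT (toKSTAT D) ≤ coeffBound (scale D) n (maxWeightELDL D)
toKSTAT-maxCoeff D = ℕP.⊔-lub (maxCoeffs-≤ (bounded false)) (maxCoeffs-≤ (bounded true))
  where
  bounded : ∀ s → All (CoeffBounded {scale D} {maxWeightELDL D}) (forms (scale D) s (withDefault D))
  bounded s = forms-bounded s (withDefault D) (length-withDefault<scale D) (maxWeight-withDefault D)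

module _ (D : (n : ℕ) → ELDL n) (length-poly : PolyBounded (λ n → length (D n))) where

  private
    length-power : PowerBounded (λ n → length (D n))
    length-power = polyBounded⇒powerBounded length-poly

  toKSTAT-size-poly : PolyBounded (λ n → sizeKSTAT (toKSTAT (D n)))
  toKSTAT-size-poly = powerBounded⇒polyBounded
    (powerBounded-mono (λ n → ℕP.≤-reflexive (toKSTAT-size (D n))) (powerBounded-+ twice twice))
    where
    twice : PowerBounded (λ n → suc (length (D n)) * 2)
    twice = powerBounded-* (powerBounded-+ (powerBounded-const 1) length-power) (powerBounded-const 2)

  toKSTAT-maxCoeff-poly : PolyBounded (λ n → maxWeightELDL (D n)) →
                          PolyBounded (λ n → maxCoeffKSTAT (toKSTAT (D n)))
  toKSTAT-maxCoeff-poly weight-poly = powerBounded⇒polyBounded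
    (powerBounded-mono (λ n → toKSTAT-maxCoeff (D n))
      (powerBounded-+ (powerBounded-const 1)
        (powerBounded-+ (powerBounded-+ K (powerBounded-* K (powerBounded-* powerBounded-id W)))
                        (powerBounded-* K W))))
    where
    K : PowerBounded (λ n → scale (D n))
    K = powerBounded-+ (powerBounded-const 2) length-power
    W : PowerBounded (λ n → maxWeightELDL (D n))
    W = polyBounded⇒powerBounded weight-poly

toKSTAT-computes : (f : BoolFamily) (D : (n : ℕ) → ELDL n) → (∀ n x → evalELDL (D n) x ≡ f n x) →
                   ∀ n x → evalKSTAT (toKSTAT (D n)) x ≡ f n x
toKSTAT-computes f D D≡f n x = trans (toKSTAT-correct (D n) x) (D≡f n x)

theorem8 : ((f : BoolFamily) → InELDL f → InKSTAT f)
    × ((f : BoolFamily) → InELDLpoly f → InKSTATpoly f)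
theorem8 =
    (λ { f (D , length-poly , D≡f) →
         (λ n → toKSTAT (D n)) , toKSTAT-size-poly D length-poly , toKSTAT-computes f D D≡f })
  , (λ { f (D , length-poly , weight-poly , D≡f) →
         (λ n → toKSTAT (D n)) , toKSTAT-size-poly D length-poly
         , toKSTAT-maxCoeff-poly D length-poly weight-poly , toKSTAT-computes f D D≡f })
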